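{- $\mathcal{L}^{\mathrm{LNBF}_{\Delta(n)}}_{\mathrm{ISA}}(n) \in \Omega\bigl(\max\bigl\{\frac{n^2}{2^{\Delta(n)} \log_2 n}, n\bigr\}\bigr)$ for any $\Delta\colon \mathbb{N} \to \mathbb{N}$. In particular, $\mathcal{L}^{\mathrm{BF}}_{\mathrm{ISA}}(n) \in \Omega\bigl(\frac{n^2}{\log_2 n}\bigr)$.
   Context: $\mathcal{L}^{\mathbf{M}}_F(n) = \max\{\sum_{i=1}^p b(r_{V_i}(f_n)) \mid b \in \mathcal{N}_{\mathbf{M}},\ V_1,\dots,V_p \text{ partition of } [n]\}$, where $r_V(f)$ is the number of distinct subfunctions of $f$ on $V$ obtained by fixing the variables outside $V$, and $\mathcal{N}_{\mathbf{M}}$ is the set of non-decreasing $b\colon \mathbb{N}_{>0}\to\mathbb{N}$ with $\mathbf{M}(f) \ge \sum_i b(r_{V_i}(f))$ for every Boolean $f$ and partition of its variables. $\mathrm{BF}(f)$ is the minimum number of non-constant leaves of a binary formula (arbitrary binary gates, leaves constants or literals) computing $f$; $\mathrm{LNBF}_\delta(f)$ is the minimum size of a formula $\varphi'$ on $n+\delta$ variables with $f(a) = \bigvee_{b\in\{0,1\}^\delta}f_{\varphi'}(a,b)$. $\mathrm{ISA}_{k,\ell}$: a $k$-bit primary pointer selects one of $2^k$ $\ell$-bit secondary pointers, which selects one of $2^\ell$ data bits, which is output. $\mathrm{ISA}_n$ equals $\mathrm{ISA}_{k,k+\lceil\log_2 k\rceil}$ when $n = k + 2^k(k+\lceil\log_2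 k\rceil) + 2^{k+\lceil\log_2 k\rceil}$, is that function on the first $n'$ bits for the largest such $n' < n$ otherwise, and is constantly $0$ for $n<5$. -}

module Defs where

open import Data.Bool using (Bool; true; false; if_then_else_; _∨_; _∧_)
import Data.Bool as B
open import Data.Nat using (ℕ; zero; suc; _+_; _*_; _^_; _≤_; _<_; _≤ᵇ_; _<?_)
open import Data.Nat.Logarithm using (⌈log₂_⌉)
open import Data.Fin using (Fin; fromℕ<)
import Data.Fin as F
open import Data.List using (List; []; _∷_; map; length; concatMap; deduplicate)
import Data.List.Properties as LP
open import Data.Vec.Functional as VF using (Vector)
open import Data.Product using (Σ; ∃; _×_; _,_)
open import Relation.Binary.PropositionalEquality using (_≡_)
open import Relation.Nullary using (yes; no; does)

Assignment : ℕ → Set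
Assignment m = Fin m → Bool

BoolFn : ℕ → Set
BoolFn m = Assignment m → Bool

allAssign : (m : ℕ) → List (Assignment m)
allAssign zero    = (λ ()) ∷ []
allAssign (suc m) = concatMap (λ a → (true VF.∷ a) ∷ (false VF.∷ a) ∷ []) (allAssign m)

VarSet : ℕ → Set
VarSet m = Fin m → Bool

merge : ∀ {m} → VarSet m → Assignment m → Assignment m → Assignment m
merge V σ ρ i = if V i then σ i else ρ i

subfnTable : ∀ {m} → BoolFn m → VarSet m → Assignment m → List Bool
subfnTable {m} f V ρ = map (λ σ → f (merge V σ ρ)) (allAssign m)

r : ∀ {m} → VarSet m → BoolFn m → ℕ
r {m} V f = length (deduplicate (LP.≡-dec B._≟_) (map (subfnTable f V) (allAssign m)))

-- Partitions V_1,…,V_p of [m] : surjective colourings Fin m → Fin p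
-- (every block non-empty, blocks disjoint and covering)

record Partition (m p : ℕ) : Set where
  field
    colour : Fin m → Fin p
    surj   : ∀ (i : Fin p) → ∃ λ (j : Fin m) → colour j ≡ i

block : ∀ {m p} → Partition m p → Fin p → VarSet m
block π i j = does (Partition.colour π j F.≟ i)

sumFin : ∀ p → (Fin p → ℕ) → ℕ
sumFin zero    g = 0
sumFin (suc p) g = g F.zero + sumFin p (λ i → g (F.suc i))

nsum : ∀ {m p} → (ℕ → ℕ) → Partition m p → BoolFn m → ℕ
nsum {p = p} b π f = sumFin p (λ i → b (r (block π i) f))

-- Complexity measures are given through "M(f) ≥ s" predicates.

MeasureGE : Set₁
MeasureGE = ∀ {m} → BoolFn m → ℕ → Set

NonDecreasing : (ℕ → ℕ) → Set
NonDecreasing b = ∀ {x y} → x ≤ y → b x ≤ b y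

InN : MeasureGE → (ℕ → ℕ) → Set
InN M b = NonDecreasing b
        × (∀ m (f : BoolFn m) p (π : Partition m p) → M f (nsum b π f))

-- "𝓛^M_F(n) satisfies P" for an upward closed P, i.e. some admissible
-- value Σ_i b(r_{V_i}(F n)) satisfies P.  With P = (s ≤_) this is
-- exactly 𝓛^M_F(n) ≥ s.
LSat : MeasureGE → ((n : ℕ) → BoolFn n) → ℕ → (ℕ → Set) → Set
LSat M F n P = Σ (ℕ → ℕ) λ b → InN M b × Σ ℕ λ p → Σ (Partition n p) λ π → P (nsum b π (F n))

data Formula (m : ℕ) : Set where
  const : Bool → Formula m
  lit   : Fin m → Bool → Formula m
  gate  : (Bool → Bool → Bool) → Formula m → Formula m → Formula m

eval : ∀ {m} → Formula m → Assignment m → Bool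
eval (const c)    a = c
eval (lit i true)  a = a i
eval (lit i false) a = B.not (a i)
eval (gate g φ ψ) a = g (eval φ a) (eval ψ a)

size : ∀ {m} → Formula m → ℕ
size (const _)    = 0
size (lit _ _)    = 1
size (gate _ φ ψ) = size φ + size ψ

BF≥ : MeasureGE
BF≥ {m} f s = ∀ (φ : Formula m) → (∀ a → eval φ a ≡ f a) → s ≤ size φ

bigOr : (δ : ℕ) → (Assignment δ → Bool) → Bool
bigOr zero    h = h (λ ())
bigOr (suc δ) h = bigOr δ (λ b → h (true VF.∷ b)) ∨ bigOr δ (λ b → h (false VF.∷ b))

LNBF≥ : ℕ → MeasureGE
LNBF≥ δ {m} f s = ∀ (φ : Formula (m + δ))
  → (∀ a → f a ≡ bigOr δ (λ b → eval φ (a VF.++ b))) → s ≤ size φ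

-- bits indexed by ℕ (out-of-range bits read as false; never used)
bitAt : ∀ {n} → Assignment n → ℕ → Bool
bitAt {n} x i with i <? n
... | yes i<n = x (fromℕ< i<n)
... | no  _   = false

num : (ℕ → Bool) → ℕ → ℕ → ℕ
num x start zero      = 0
num x start (suc len) = (if x start then 1 else 0) + 2 * num x (suc start) len

-- ISA_{k,ℓ} on variables 0 … k + 2^k ℓ + 2^ℓ − 1 : primary pointer in bits
-- [0,k), secondary pointers in the 2^k blocks of ℓ bits that follow,
-- data bits in the last 2^ℓ positions.
isaKL : ℕ → ℕ → (ℕ → Bool) → Bool
isaKL k ℓ x = x (k + 2 ^ k * ℓ + num x (k + num x 0 k * ℓ) ℓ)

ell : ℕ → ℕ
ell k = k + ⌈log₂ k ⌉

isaLen : ℕ → ℕ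
isaLen k = k + 2 ^ k * ell k + 2 ^ ell k

-- largest k ∈ [1,bound] with isaLen k ≤ n (0 if none)
bestK : ℕ → ℕ → ℕ
bestK n zero = 0
bestK n (suc j) = if isaLen (suc j) ≤ᵇ n then suc j else bestK n j

ISA : (n : ℕ) → BoolFn n
ISA n x = if n ≤ᵇ 4 then false else isaKL (bestK n n) (ell (bestK n n)) (bitAt x)

-- Nechiporuk's method. Let a formula with δ guessed inputs have s ≥ 1 leaves reading
-- variables of a block V. The truth tables on V of its subformulas, closed under
-- unary post-composition, number at most 64^s / 16, and OR-ing over the 2^δ guesses
-- gives r_V(f) ≤ 2^(6 s 2^δ); if s = 0 every subfunction is constant and r_V(f) ≤ 2.
-- Distinct blocks own distinct leaves, so every non-decreasing b with b(r) ≤ s under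
-- these bounds is in 𝒩_LNBF_δ; BF is the case δ = 0.
-- In ISA with a k-bit primary and ℓ-bit secondary pointers, fixing the primary
-- pointer to j and the data bits at will shows that the j-th secondary pointer has
-- 2^(2^ℓ) subfunctions, so b(r) = ⌈(⌈log₂ r⌉ − 1) / (6·2^δ + 1)⌉ adds up to about
-- 2^k·2^ℓ / 2^δ ≥ k·4^k / 2^δ, of order n² / (2^δ log₂ n) since n ≤ 18·k·2^k and
-- k ≤ log₂ n. Each data bit has the three subfunctions x, 0 and 1, and there are
-- 2^ℓ ≥ n / 18 of them.

module Submission where

open import Defs
open import Data.Nat using (ℕ; _+_; _*_; _^_; _≤_)
open import Data.Nat.Logarithm using (⌈log₂_⌉)
open import Data.Product using (Σ; _×_)

open import Data.Bool as B using (Bool; true; false; if_then_else_; _∨_; not; T)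
open import Data.Empty using (⊥-elim)
open import Data.Fin as F using (Fin; toℕ; fromℕ<; _↑ˡ_)
import Data.Fin.Properties as FP
open import Data.List using (List; []; _∷_; _++_; map; length; deduplicate; zipWith; cartesianProductWith; cartesianProduct; tabulate)
import Data.List.Properties as LP
open import Data.List.Membership.Propositional using (_∈_; lose)
import Data.List.Membership.Propositional.Properties as MP
open import Data.List.Relation.Binary.Subset.Propositional using (_⊆_)
import Data.List.Relation.Unary.All as All
import Data.List.Relation.Unary.AllPairs as AP
open import Data.List.Relation.Unary.Any using (here; there)
open import Data.List.Relation.Unary.Unique.Propositional using (Unique)
import Data.List.Relation.Unary.Unique.DecPropositional.Properties as UDP
import Data.List.Relation.Unary.Unique.Propositional.Properties as UP
import Data.Nat as ℕ
open import Data.Nat using (zero; suc; _∸_; _⊔_; _<_; _≤ᵇ_; _<?_; _≤?_; z≤n; s≤s; s<s; ⌊_/2⌋; ⌈_/2⌉; NonZero; >-nonZero)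
open import Data.Nat.DivMod using (_/_; _%_; /-monoˡ-≤; m<n*o⇒m/o<n; m≡m%n+[m/n]*n; m%n<n; +-distrib-/; m*n%n≡0; m<n⇒m%n≡m; m*n/n≡m; m<n⇒m/n≡0)
open import Data.Nat.Induction using (<-rec)
open import Data.Nat.Logarithm using (⌈log₂⌉-mono-≤; ⌈log₂2^n⌉≡n; ⌈log₂⌈n/2⌉⌉≡⌈log₂n⌉∸1)
open import Data.Nat.Properties
open import Algebra.Properties.CommutativeSemigroup +-commutativeSemigroup using () renaming (interchange to +-interchange)
open import Data.Nat.Tactic.RingSolver using (solve-∀)
open import Data.Product using (_,_; proj₁; proj₂; ∃)
open import Data.Sum using (_⊎_; inj₁; inj₂)
import Data.Vec.Functional as VF
import Data.Vec.Functional.Properties as VFP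
open import Function using (_∘_; id)
open import Relation.Binary.PropositionalEquality
open import Relation.Binary.Definitions using (DecidableEquality)
open import Relation.Nullary using (yes; no; does)
open import Relation.Nullary.Decidable using (dec-true; dec-false)

unique-⊆⇒length≤ : ∀ {A : Set} {xs ys : List A} → Unique xs → xs ⊆ ys → length xs ≤ length ys
unique-⊆⇒length≤ {xs = []} _ _ = z≤n
unique-⊆⇒length≤ {xs = x ∷ xs} {ys} (x∉xs AP.∷ !xs) xs⊆ys with MP.∈-∃++ (xs⊆ys (here refl))
... | us , vs , refl = begin
  suc (length xs)              ≤⟨ s≤s (unique-⊆⇒length≤ !xs xs⊆us++vs) ⟩
  suc (length (us ++ vs))      ≡⟨ cong suc (LP.length-++ us) ⟩
  suc (length us + length vs)  ≡⟨ sym (+-suc (length us) (length vs)) ⟩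
  length us + length (x ∷ vs)  ≡⟨ sym (LP.length-++ us) ⟩
  length (us ++ x ∷ vs)        ∎
  where
  open ≤-Reasoning
  xs⊆us++vs : xs ⊆ us ++ vs
  xs⊆us++vs {y} y∈xs with MP.∈-++⁻ us (xs⊆ys (there y∈xs))
  ... | inj₁ y∈us         = MP.∈-++⁺ˡ y∈us
  ... | inj₂ (here refl)  = ⊥-elim (All.lookup x∉xs y∈xs refl)
  ... | inj₂ (there y∈vs) = MP.∈-++⁺ʳ us y∈vs

length-cartesianProductWith : ∀ {A B C : Set} (f : A → B → C) xs ys
  → length (cartesianProductWith f xs ys) ≡ length xs * length ys
length-cartesianProductWith f []       ys = refl
length-cartesianProductWith f (x ∷ xs) ys = begin
  length (map (f x) ys ++ cartesianProductWith f xs ys) ≡⟨ LP.length-++ (map (f x) ys) ⟩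
  length (map (f x) ys) + length (cartesianProductWith f xs ys)
    ≡⟨ cong₂ _+_ (LP.length-map (f x) ys) (length-cartesianProductWith f xs ys) ⟩
  length ys + length xs * length ys ∎
  where open ≡-Reasoning

zipWith-map-map : ∀ {A B C D : Set} (G : B → C → D) (g : A → B) (h : A → C) xs
  → zipWith G (map g xs) (map h xs) ≡ map (λ x → G (g x) (h x)) xs
zipWith-map-map G g h []       = refl
zipWith-map-map G g h (x ∷ xs) = cong (G (g x) (h x) ∷_) (zipWith-map-map G g h xs)

-- Counting subfunctions

subfnTables : ∀ {m} → BoolFn m → VarSet m → List (List Bool)
subfnTables {m} f V = map (subfnTable f V) (allAssign m)

private
  _≟ₜ_ : DecidableEquality (List Bool)
  _≟ₜ_ = LP.≡-dec B._≟_

r≤length : ∀ {m} (f : BoolFn m) V (tables : List (List Bool))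
  → (∀ ρ → subfnTable f V ρ ∈ tables) → r V f ≤ length tables
r≤length {m} f V tables complete =
  unique-⊆⇒length≤ (UDP.deduplicate-! _≟ₜ_ (subfnTables f V)) ⊆tables
  where
  ⊆tables : deduplicate _≟ₜ_ (subfnTables f V) ⊆ tables
  ⊆tables t∈ with MP.∈-map⁻ (subfnTable f V) (MP.∈-deduplicate⁻ _≟ₜ_ (subfnTables f V) t∈)
  ... | ρ , _ , refl = complete ρ

allAssign-complete : ∀ m (a : Assignment m) → ∃ λ a′ → a′ ∈ allAssign m × a′ ≗ a
allAssign-complete zero    a = _ , here refl , λ ()
allAssign-complete (suc m) a with allAssign-complete m (a ∘ F.suc)
... | a′ , a′∈ , a′≗ = a F.zero VF.∷ a′ , MP.∈-concatMap⁺ (λ a → (true VF.∷ a) ∷ (false VF.∷ a) ∷ []) (lose a′∈ (head∈ (a F.zero))) , ≗a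
  where
  head∈ : ∀ x → (x VF.∷ a′) ∈ (true VF.∷ a′) ∷ (false VF.∷ a′) ∷ []
  head∈ true  = here refl
  head∈ false = there (here refl)
  ≗a : a F.zero VF.∷ a′ ≗ a
  ≗a F.zero    = refl
  ≗a (F.suc i) = a′≗ i

Extensional : ∀ {m} → BoolFn m → Set
Extensional f = ∀ {x y} → x ≗ y → f x ≡ f y

module _ {m} {f : BoolFn m} (f-ext : Extensional f) (V : VarSet m) where

  merge-≗ : ∀ {σ σ′ ρ ρ′ : Assignment m} → σ ≗ σ′ → ρ ≗ ρ′ → merge V σ ρ ≗ merge V σ′ ρ′
  merge-≗ σ≗ ρ≗ i = cong₂ (if V i then_else_) (σ≗ i) (ρ≗ i)

  subfnTable-injective : ∀ {ρ ρ′} → subfnTable f V ρ ≡ subfnTable f V ρ′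
    → ∀ σ → f (merge V σ ρ) ≡ f (merge V σ ρ′)
  subfnTable-injective {ρ} {ρ′} eq σ with allAssign-complete m σ
  ... | σ′ , σ′∈ , σ′≗σ = begin
    f (merge V σ ρ)    ≡⟨ f-ext (merge-≗ (sym ∘ σ′≗σ) (λ _ → refl)) ⟩
    f (merge V σ′ ρ)   ≡⟨ map-≡-at eq σ′∈ ⟩
    f (merge V σ′ ρ′)  ≡⟨ f-ext (merge-≗ σ′≗σ (λ _ → refl)) ⟩
    f (merge V σ ρ′)   ∎
    where
    open ≡-Reasoning
    map-≡-at : ∀ {A B : Set} {g h : A → B} {xs x} → map g xs ≡ map h xs → x ∈ xs → g x ≡ h x
    map-≡-at {xs = _ ∷ _} eq (here refl) = proj₁ (LP.∷-injective eq)
    map-≡-at {xs = _ ∷ _} eq (there x∈) = map-≡-at (proj₂ (LP.∷-injective eq)) x∈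

  subfnTable-∈ : ∀ ρ → subfnTable f V ρ ∈ subfnTables f V
  subfnTable-∈ ρ with allAssign-complete m ρ
  ... | ρ′ , ρ′∈ , ρ′≗ρ = subst (_∈ subfnTables f V)
    (LP.map-cong (λ σ → f-ext (merge-≗ (λ _ → refl) ρ′≗ρ)) (allAssign m)) (MP.∈-map⁺ (subfnTable f V) ρ′∈)

  distinctSubfns⇒≤r : ∀ {N} (ρ : Fin N → Assignment m)
    → (∀ {c c′} → (∀ σ → f (merge V σ (ρ c)) ≡ f (merge V σ (ρ c′))) → c ≡ c′) → N ≤ r V f
  distinctSubfns⇒≤r {N} ρ distinct = subst (_≤ r V f) (LP.length-tabulate tables)
    (unique-⊆⇒length≤ (UP.tabulate⁺ (distinct ∘ subfnTable-injective)) ⊆dedup)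
    where
    tables : Fin N → List Bool
    tables = subfnTable f V ∘ ρ
    ⊆dedup : tabulate tables ⊆ deduplicate _≟ₜ_ (subfnTables f V)
    ⊆dedup t∈ with MP.∈-tabulate⁻ t∈
    ... | c , refl = MP.∈-deduplicate⁺ _≟ₜ_ (subfnTable-∈ (ρ c))

-- Nechiporuk's bound for formulas with guessed inputs

bools : List Bool
bools = true ∷ false ∷ []

∈-bools : ∀ b → b ∈ bools
∈-bools true  = here refl
∈-bools false = there (here refl)

unaryFns : List (Bool → Bool)
unaryFns = cartesianProductWith (λ a b x → if x then a else b) bools bools

unaryFns-complete : ∀ (h : Bool → Bool) → ∃ λ u → u ∈ unaryFns × u ≗ h
unaryFns-complete h = _ , MP.∈-cartesianProductWith⁺ (λ a b x → if x then a else b) (∈-bools (h true)) (∈-bools (h false)) , ≗h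
  where
  ≗h : (λ x → if x then h true else h false) ≗ h
  ≗h true  = refl
  ≗h false = refl

binaryFns : List (Bool → Bool → Bool)
binaryFns = cartesianProductWith (λ u v x → if x then u else v) unaryFns unaryFns

binaryFns-complete : ∀ (G : Bool → Bool → Bool) → ∃ λ G′ → G′ ∈ binaryFns × ∀ x y → G′ x y ≡ G x y
binaryFns-complete G with unaryFns-complete (G true) | unaryFns-complete (G false)
... | u , u∈ , u≗ | v , v∈ , v≗ = _ , MP.∈-cartesianProductWith⁺ (λ u v x → if x then u else v) u∈ v∈ , ≗G
  where
  ≗G : ∀ x y → (if x then u else v) y ≡ G x y
  ≗G true  = u≗
  ≗G false = v≗

leavesIn : ∀ {m} → VarSet m → Formula m → ℕ
leavesIn W (const _)    = 0
leavesIn W (lit i _)    = if W i then 1 else 0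
leavesIn W (gate _ φ ψ) = leavesIn W φ + leavesIn W ψ

literal : Bool → Bool → Bool
literal true  = id
literal false = not

eval-lit : ∀ {m} (i : Fin m) pol a → eval (lit i pol) a ≡ literal pol (a i)
eval-lit i true  a = refl
eval-lit i false a = refl

eval-≗ : ∀ {m} (φ : Formula m) {a a′} → a ≗ a′ → eval φ a ≡ eval φ a′
eval-≗ (const _)     a≗ = refl
eval-≗ (lit i true)  a≗ = a≗ i
eval-≗ (lit i false) a≗ = cong not (a≗ i)
eval-≗ (gate g φ ψ)  a≗ = cong₂ g (eval-≗ φ a≗) (eval-≗ ψ a≗)

module Tables {m} (W : VarSet m) (pts : List (Assignment m)) where

  table : Formula m → Assignment m → List Bool
  table φ ρ = map (λ p → eval φ (merge W p ρ)) pts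

  -- Closure under unary post-composition is what lets a gate with one W-free
  -- input reuse the family of its other input.
  Closed : List (List Bool) → Formula m → Set
  Closed L φ = ∀ ρ (h : Bool → Bool) → map h (table φ ρ) ∈ L

  table-∈ : ∀ {L} φ → Closed L φ → ∀ ρ → table φ ρ ∈ L
  table-∈ {L} φ closed ρ = subst (_∈ L) (LP.map-id (table φ ρ)) (closed ρ id)

  eval-free : ∀ φ → leavesIn W φ ≡ 0 → ∀ p p′ ρ → eval φ (merge W p ρ) ≡ eval φ (merge W p′ ρ)
  eval-free (const _)    _  _ _ _ = refl
  eval-free (lit i true)  _ p p′ ρ with W i
  ... | false = refl
  eval-free (lit i false) _ p p′ ρ with W i
  ... | false = refl
  eval-free (gate g φ ψ) s≡0 p p′ ρ =
    cong₂ g (eval-free φ (m+n≡0⇒m≡0 _ s≡0) p p′ ρ) (eval-free ψ (m+n≡0⇒n≡0 (leavesIn W φ) s≡0) p p′ ρ)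

  map-table : ∀ φ ρ (h : Bool → Bool) → map h (table φ ρ) ≡ map (λ p → h (eval φ (merge W p ρ))) pts
  map-table φ ρ h = sym (LP.map-∘ pts)

  litTable : Fin m → (Bool → Bool) → List Bool
  litTable i u = map (λ p → u (p i)) pts

  litTables : Fin m → List (List Bool)
  litTables i = map (litTable i) unaryFns

  closed-lit : ∀ {i} → W i ≡ true → ∀ pol → Closed (litTables i) (lit i pol)
  closed-lit {i} Wi pol ρ h with unaryFns-complete (h ∘ literal pol)
  ... | u , u∈ , u≗ = subst (_∈ litTables i) (sym table≡) (MP.∈-map⁺ (litTable i) u∈)
    where
    merge-in : ∀ p → merge W p ρ i ≡ p i
    merge-in p rewrite Wi = refl
    table≡ : map h (table (lit i pol) ρ) ≡ litTable i u
    table≡ = trans (map-table (lit i pol) ρ h) (LP.map-cong (λ p →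
      trans (cong h (trans (eval-lit i pol _) (cong (literal pol) (merge-in p)))) (sym (u≗ (p i)))) pts)

  closed-gateˡ : ∀ {L} φ ψ g → Closed L φ → leavesIn W ψ ≡ 0 → Closed L (gate g φ ψ)
  closed-gateˡ {L} φ ψ g closed free ρ h = subst (_∈ L) (sym table≡) (closed ρ (λ x → h (g x c)))
    where
    c : Bool
    c = eval ψ (merge W ρ ρ)
    table≡ : map h (table (gate g φ ψ) ρ) ≡ map (λ x → h (g x c)) (table φ ρ)
    table≡ = trans (map-table (gate g φ ψ) ρ h)
      (trans (LP.map-cong (λ p → cong (h ∘ g _) (eval-free ψ free p ρ ρ)) pts) (LP.map-∘ pts))

  closed-gateʳ : ∀ {L} φ ψ g → Closed L ψ → leavesIn W φ ≡ 0 → Closed L (gate g φ ψ)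
  closed-gateʳ {L} φ ψ g closed free ρ h = subst (_∈ L) (sym table≡) (closed ρ (λ y → h (g c y)))
    where
    c : Bool
    c = eval φ (merge W ρ ρ)
    table≡ : map h (table (gate g φ ψ) ρ) ≡ map (λ y → h (g c y)) (table ψ ρ)
    table≡ = trans (map-table (gate g φ ψ) ρ h)
      (trans (LP.map-cong (λ p → cong (λ x → h (g x _)) (eval-free φ free p ρ ρ)) pts) (LP.map-∘ pts))

  gateTable : (Bool → Bool → Bool) → List Bool × List Bool → List Bool
  gateTable G (t₁ , t₂) = zipWith G t₁ t₂

  gateTables : List (List Bool) → List (List Bool) → List (List Bool)
  gateTables L₁ L₂ = cartesianProductWith gateTable binaryFns (cartesianProduct L₁ L₂)

  length-gateTables : ∀ L₁ L₂ → length (gateTables L₁ L₂) ≡ 16 * (length L₁ * length L₂)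
  length-gateTables L₁ L₂ = trans (length-cartesianProductWith gateTable binaryFns (cartesianProduct L₁ L₂))
    (cong (16 *_) (length-cartesianProductWith _,_ L₁ L₂))

  closed-gate : ∀ {L₁ L₂} φ ψ g → Closed L₁ φ → Closed L₂ ψ → Closed (gateTables L₁ L₂) (gate g φ ψ)
  closed-gate {L₁} {L₂} φ ψ g closed₁ closed₂ ρ h with binaryFns-complete (λ x y → h (g x y))
  ... | G , G∈ , G≗ = subst (_∈ gateTables L₁ L₂) (sym table≡)
    (MP.∈-cartesianProductWith⁺ gateTable G∈ (MP.∈-cartesianProductWith⁺ _,_ (table-∈ φ closed₁ ρ) (table-∈ ψ closed₂ ρ)))
    where
    table≡ : map h (table (gate g φ ψ) ρ) ≡ zipWith G (table φ ρ) (table ψ ρ)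
    table≡ = trans (map-table (gate g φ ψ) ρ h)
      (trans (LP.map-cong (λ p → sym (G≗ _ _)) pts) (sym (zipWith-map-map G (λ p → eval φ (merge W p ρ)) (λ p → eval ψ (merge W p ρ)) pts)))

  NechiporukFamily : Formula m → Set
  NechiporukFamily φ = leavesIn W φ ≡ 0 ⊎ ∃ λ L → Closed L φ × 16 * length L ≤ 64 ^ leavesIn W φ

  nechiporukFamily : ∀ φ → NechiporukFamily φ
  nechiporukFamily (const _) = inj₁ refl
  nechiporukFamily (lit i pol) with W i in Wi
  ... | false = inj₁ refl
  ... | true  = inj₂ (litTables i , closed-lit Wi pol , ≤-reflexive (cong (16 *_) (LP.length-map (litTable i) unaryFns)))
  nechiporukFamily (gate g φ ψ) with nechiporukFamily φ | nechiporukFamily ψ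
  ... | inj₁ free₁ | inj₁ free₂ = inj₁ (cong₂ _+_ free₁ free₂)
  ... | inj₂ (L , closed , bound) | inj₁ free =
    inj₂ (L , closed-gateˡ φ ψ g closed free , ≤-trans bound (^-monoʳ-≤ 64 (m≤m+n (leavesIn W φ) (leavesIn W ψ))))
  ... | inj₁ free | inj₂ (L , closed , bound) =
    inj₂ (L , closed-gateʳ φ ψ g closed free , ≤-trans bound (^-monoʳ-≤ 64 (m≤n+m (leavesIn W ψ) (leavesIn W φ))))
  ... | inj₂ (L₁ , closed₁ , bound₁) | inj₂ (L₂ , closed₂ , bound₂) =
    inj₂ (gateTables L₁ L₂ , closed-gate φ ψ g closed₁ closed₂ , bound)
    where
    open ≤-Reasoning
    bound : 16 * length (gateTables L₁ L₂) ≤ 64 ^ (leavesIn W φ + leavesIn W ψ)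
    bound = begin
      16 * length (gateTables L₁ L₂)        ≡⟨ cong (16 *_) (length-gateTables L₁ L₂) ⟩
      16 * (16 * (length L₁ * length L₂))    ≡⟨ lemma (length L₁) (length L₂) ⟩
      (16 * length L₁) * (16 * length L₂)    ≤⟨ *-mono-≤ bound₁ bound₂ ⟩
      64 ^ leavesIn W φ * 64 ^ leavesIn W ψ  ≡⟨ sym (^-distribˡ-+-* 64 (leavesIn W φ) _) ⟩
      64 ^ (leavesIn W φ + leavesIn W ψ)     ∎
      where
      lemma : ∀ a b → 16 * (16 * (a * b)) ≡ (16 * a) * (16 * b)
      lemma = solve-∀

orTables : ℕ → List (List Bool) → List (List Bool)
orTables zero    L = L
orTables (suc δ) L = cartesianProductWith (zipWith _∨_) (orTables δ L) (orTables δ L)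

length-orTables : ∀ δ L → length (orTables δ L) ≡ length L ^ 2 ^ δ
length-orTables zero    L = sym (*-identityʳ (length L))
length-orTables (suc δ) L = begin
  length (orTables (suc δ) L)               ≡⟨ length-cartesianProductWith (zipWith _∨_) (orTables δ L) _ ⟩
  length (orTables δ L) * length (orTables δ L) ≡⟨ cong₂ _*_ (length-orTables δ L) (length-orTables δ L) ⟩
  length L ^ 2 ^ δ * length L ^ 2 ^ δ       ≡⟨ sym (^-distribˡ-+-* (length L) (2 ^ δ) _) ⟩
  length L ^ (2 ^ δ + 2 ^ δ)                ≡⟨ cong (λ e → length L ^ (2 ^ δ + e)) (sym (+-identityʳ (2 ^ δ))) ⟩
  length L ^ 2 ^ suc δ                      ∎
  where open ≡-Reasoning

orTables-∈ : ∀ {A : Set} (pts : List A) δ L (G : A → Assignment δ → Bool)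
  → (∀ p {b b′} → b ≗ b′ → G p b ≡ G p b′)
  → (∀ b → map (λ p → G p b) pts ∈ L) → map (λ p → bigOr δ (G p)) pts ∈ orTables δ L
orTables-∈ pts zero    L G G-ext G∈ = subst (_∈ L) (LP.map-cong (λ p → G-ext p (λ ())) pts) (G∈ (λ ()))
orTables-∈ {A} pts (suc δ) L G G-ext G∈ =
  subst (_∈ orTables (suc δ) L) (zipWith-map-map _∨_ (λ p → bigOr δ (Gᵗ p)) (λ p → bigOr δ (Gᶠ p)) pts)
    (MP.∈-cartesianProductWith⁺ (zipWith _∨_) (orTables-∈ pts δ L Gᵗ (λ p → G-ext p ∘ ∷-≗ true) (G∈ ∘ (true VF.∷_)))
                                               (orTables-∈ pts δ L Gᶠ (λ p → G-ext p ∘ ∷-≗ false) (G∈ ∘ (false VF.∷_))))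
  where
  Gᵗ Gᶠ : A → Assignment δ → Bool
  Gᵗ p b = G p (true VF.∷ b)
  Gᶠ p b = G p (false VF.∷ b)
  ∷-≗ : ∀ x {b b′ : Assignment δ} → b ≗ b′ → (x VF.∷ b) ≗ (x VF.∷ b′)
  ∷-≗ x b≗ F.zero    = refl
  ∷-≗ x b≗ (F.suc i) = b≗ i

bigOr-cong : ∀ δ {h h′ : Assignment δ → Bool} → (∀ b → h b ≡ h′ b) → bigOr δ h ≡ bigOr δ h′
bigOr-cong zero    h≡ = h≡ _
bigOr-cong (suc δ) h≡ = cong₂ _∨_ (bigOr-cong δ (h≡ ∘ (true VF.∷_))) (bigOr-cong δ (h≡ ∘ (false VF.∷_)))

nechiporukBound : ℕ → ℕ → ℕ
nechiporukBound δ s = 2 ⊔ 2 ^ (6 * s * 2 ^ δ)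

constTables : ∀ {A : Set} → List A → List (List Bool)
constTables pts = map (λ c → map (λ _ → c) pts) bools

unguessed : ∀ {m} δ → VarSet m → VarSet (m + δ)
unguessed δ V = V VF.++ λ _ → false

module _ {m δ} (f : BoolFn m) (φ : Formula (m + δ))
         (f≡φ : ∀ a → f a ≡ bigOr δ (λ b → eval φ (a VF.++ b))) (V : VarSet m) where

  private
    noGuess : ∀ {k} → Assignment k
    noGuess _ = false

  open Tables (unguessed δ V) (map (VF._++ noGuess) (allAssign m))

  merge-++ : ∀ (σ ρ : Assignment m) (b : Assignment δ)
    → merge (unguessed δ V) (σ VF.++ noGuess) (ρ VF.++ b) ≗ merge V σ ρ VF.++ b
  merge-++ σ ρ b i with F.splitAt m i
  ... | inj₁ _ = refl
  ... | inj₂ _ = refl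

  ++-≗ : ∀ (ρ : Assignment m) {b b′ : Assignment δ} → b ≗ b′ → ρ VF.++ b ≗ ρ VF.++ b′
  ++-≗ ρ b≗ i with F.splitAt m i
  ... | inj₁ _ = refl
  ... | inj₂ j = b≗ j

  merge-≗ᵣ : ∀ p {ρ ρ′} → ρ ≗ ρ′ → merge (unguessed δ V) p ρ ≗ merge (unguessed δ V) p ρ′
  merge-≗ᵣ p ρ≗ i = cong (if unguessed δ V i then p i else_) (ρ≗ i)

  subfnTable-bigOr : ∀ ρ → subfnTable f V ρ
    ≡ map (λ p → bigOr δ (λ b → eval φ (merge (unguessed δ V) p (ρ VF.++ b)))) (map (VF._++ noGuess) (allAssign m))
  subfnTable-bigOr ρ = trans (LP.map-cong (λ σ → trans (f≡φ _)
      (bigOr-cong δ (λ b → sym (eval-≗ φ (merge-++ σ ρ b))))) (allAssign m))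
    (LP.map-∘ (allAssign m))

  r≤nechiporukBound : r V f ≤ nechiporukBound δ (leavesIn (unguessed δ V) φ)
  r≤nechiporukBound with nechiporukFamily φ
  ... | inj₁ free = ≤-trans (r≤length f V (constTables (allAssign m)) constant) (m≤m⊔n 2 (2 ^ (6 * leavesIn (unguessed δ V) φ * 2 ^ δ)))
    where
    constant : ∀ ρ → subfnTable f V ρ ∈ constTables (allAssign m)
    constant ρ = subst (_∈ constTables (allAssign m)) (sym (LP.map-cong (λ σ → trans (f≡φ _)
        (bigOr-cong δ λ b → trans (sym (eval-≗ φ (merge-++ σ ρ b))) (eval-free φ free _ noGuess (ρ VF.++ b))))
        (allAssign m)))
      (MP.∈-map⁺ (λ c → map (λ _ → c) (allAssign m)) (∈-bools _))
  ... | inj₂ (L , closed , bound) = begin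
    r V f                      ≤⟨ r≤length f V (orTables δ L) (λ ρ → subst (_∈ orTables δ L) (sym (subfnTable-bigOr ρ))
                                    (orTables-∈ _ δ L _ (λ p b≗ → eval-≗ φ (merge-≗ᵣ p (++-≗ ρ b≗))) (λ b → table-∈ φ closed (ρ VF.++ b)))) ⟩
    length (orTables δ L)      ≡⟨ length-orTables δ L ⟩
    length L ^ 2 ^ δ           ≤⟨ ^-monoˡ-≤ (2 ^ δ) (≤-trans (m≤n*m (length L) 16) bound) ⟩
    (64 ^ s) ^ 2 ^ δ           ≡⟨ cong (λ x → x ^ 2 ^ δ) (^-*-assoc 2 6 s) ⟩
    (2 ^ (6 * s)) ^ 2 ^ δ      ≡⟨ ^-*-assoc 2 (6 * s) (2 ^ δ) ⟩
    2 ^ (6 * s * 2 ^ δ)        ≤⟨ m≤n⊔m 2 _ ⟩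
    nechiporukBound δ s        ∎
    where
    open ≤-Reasoning
    s : ℕ
    s = leavesIn (unguessed δ V) φ

sumFin-mono : ∀ p {g h : Fin p → ℕ} → (∀ i → g i ≤ h i) → sumFin p g ≤ sumFin p h
sumFin-mono zero    g≤h = z≤n
sumFin-mono (suc p) g≤h = +-mono-≤ (g≤h F.zero) (sumFin-mono p (g≤h ∘ F.suc))

sumFin-+ : ∀ p (g h : Fin p → ℕ) → sumFin p (λ i → g i + h i) ≡ sumFin p g + sumFin p h
sumFin-+ zero    g h = refl
sumFin-+ (suc p) g h = trans (cong (g F.zero + h F.zero +_) (sumFin-+ p (g ∘ F.suc) (h ∘ F.suc)))
  (+-interchange (g F.zero) (h F.zero) _ _)

sumFin-zero : ∀ p → sumFin p (λ _ → 0) ≡ 0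
sumFin-zero zero    = refl
sumFin-zero (suc p) = sumFin-zero p

indicator : ∀ {p} → Fin p → Fin p → ℕ
indicator c i = if does (c F.≟ i) then 1 else 0

sumFin-indicator : ∀ p (c : Fin p) → sumFin p (indicator c) ≡ 1
sumFin-indicator (suc p) F.zero    = cong suc (sumFin-zero p)
sumFin-indicator (suc p) (F.suc c) = sumFin-indicator p c

sum-leavesIn≤size : ∀ {m p} (Ws : Fin p → VarSet m)
  → (∀ i → sumFin p (λ k → if Ws k i then 1 else 0) ≤ 1)
  → ∀ φ → sumFin p (λ k → leavesIn (Ws k) φ) ≤ size φ
sum-leavesIn≤size {p = p} Ws disjoint (const _)    = ≤-reflexive (sumFin-zero p)
sum-leavesIn≤size         Ws disjoint (lit i _)    = disjoint i
sum-leavesIn≤size {p = p} Ws disjoint (gate _ φ ψ) =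
  subst (_≤ size φ + size ψ) (sym (sumFin-+ p (λ k → leavesIn (Ws k) φ) (λ k → leavesIn (Ws k) ψ)))
    (+-mono-≤ (sum-leavesIn≤size Ws disjoint φ) (sum-leavesIn≤size Ws disjoint ψ))

Admissible : ℕ → (ℕ → ℕ) → Set
Admissible δ b = ∀ s r → r ≤ nechiporukBound δ s → b r ≤ s

admissible⇒InN-LNBF : ∀ δ {b} → NonDecreasing b → Admissible δ b → InN (LNBF≥ δ) b
admissible⇒InN-LNBF δ {b} mono admissible = mono , λ m f p π φ f≡φ → begin
  nsum b π f                                              ≤⟨ sumFin-mono p (λ k →
                                                               admissible _ _ (r≤nechiporukBound f φ f≡φ (block π k))) ⟩
  sumFin p (λ k → leavesIn (unguessed δ (block π k)) φ) ≤⟨ sum-leavesIn≤size (unguessed δ ∘ block π) (disjoint π) φ ⟩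
  size φ                                                  ∎
  where
  open ≤-Reasoning
  disjoint : ∀ {m p} (π : Partition m p) (i : Fin (m + δ))
    → sumFin p (λ k → if unguessed δ (block π k) i then 1 else 0) ≤ 1
  disjoint {m} {p} π i with F.splitAt m i
  ... | inj₁ j = ≤-reflexive (sumFin-indicator p (Partition.colour π j))
  ... | inj₂ _ = ≤-trans (≤-reflexive (sumFin-zero p)) z≤n

rename : ∀ {m m′} → (Fin m → Fin m′) → Formula m → Formula m′
rename τ (const c)    = const c
rename τ (lit i pol)  = lit (τ i) pol
rename τ (gate g φ ψ) = gate g (rename τ φ) (rename τ ψ)

size-rename : ∀ {m m′} (τ : Fin m → Fin m′) φ → size (rename τ φ) ≡ size φ
size-rename τ (const _)    = refl
size-rename τ (lit _ _)    = refl
size-rename τ (gate _ φ ψ) = cong₂ _+_ (size-rename τ φ) (size-rename τ ψ)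

eval-rename : ∀ {m m′} (τ : Fin m → Fin m′) φ a → eval (rename τ φ) a ≡ eval φ (a ∘ τ)
eval-rename τ (const _)     a = refl
eval-rename τ (lit i true)  a = refl
eval-rename τ (lit i false) a = refl
eval-rename τ (gate g φ ψ)  a = cong₂ g (eval-rename τ φ a) (eval-rename τ ψ a)

LNBF≥0⇒BF≥ : ∀ {m} (f : BoolFn m) s → LNBF≥ 0 f s → BF≥ f s
LNBF≥0⇒BF≥ {m} f s lower φ φ≡f = subst (s ≤_) (size-rename (_↑ˡ 0) φ) (lower (rename (_↑ˡ 0) φ) f≡)
  where
  f≡ : ∀ a → f a ≡ eval (rename (_↑ˡ 0) φ) (a VF.++ λ ())
  f≡ a = sym (trans (eval-rename (_↑ˡ 0) φ _) (trans (eval-≗ φ (VFP.lookup-++ˡ a (λ ()))) (φ≡f a)))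

InN-LNBF₀⇒InN-BF : ∀ {b} → InN (LNBF≥ 0) b → InN BF≥ b
InN-LNBF₀⇒InN-BF (mono , lower) = mono , λ m f p π → LNBF≥0⇒BF≥ f _ (lower m f p π)

-- The two lower-bound functions

-- ⌈ x / (d + 1) ⌉
ceilDiv : ℕ → ℕ → ℕ
ceilDiv x d = (x + d) / suc d

ceilDiv-mono : ∀ d {x y} → x ≤ y → ceilDiv x d ≤ ceilDiv y d
ceilDiv-mono d x≤y = /-monoˡ-≤ (suc d) (+-monoˡ-≤ d x≤y)

ceilDiv-≤ : ∀ d {x s} → x ≤ s * suc d → ceilDiv x d ≤ s
ceilDiv-≤ d {x} {s} x≤ = ≤-pred (m<n*o⇒m/o<n (begin-strict
  x + d             <⟨ +-monoʳ-< x (n<1+n d) ⟩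
  x + suc d         ≤⟨ +-monoˡ-≤ (suc d) x≤ ⟩
  s * suc d + suc d ≡⟨ +-comm (s * suc d) (suc d) ⟩
  suc s * suc d     ∎))
  where open ≤-Reasoning

≤ceilDiv* : ∀ d x → x ≤ ceilDiv x d * suc d
≤ceilDiv* d x = +-cancelʳ-≤ d x _ (begin
  x + d                             ≡⟨ m≡m%n+[m/n]*n (x + d) (suc d) ⟩
  (x + d) % suc d + ceilDiv x d * suc d ≤⟨ +-monoˡ-≤ _ (≤-pred (m%n<n (x + d) (suc d))) ⟩
  d + ceilDiv x d * suc d           ≡⟨ +-comm d _ ⟩
  ceilDiv x d * suc d + d           ∎)
  where open ≤-Reasoning

-- The ∸ 1 makes blocks with at most two subfunctions free (the case s = 0), and
-- rounding up keeps the measure of a pointer block positive however large δ is.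
logMeasure : ℕ → ℕ → ℕ
logMeasure δ r = ceilDiv (⌈log₂ r ⌉ ∸ 1) (6 * 2 ^ δ)

logMeasure-mono : ∀ δ → NonDecreasing (logMeasure δ)
logMeasure-mono δ r≤r′ = ceilDiv-mono (6 * 2 ^ δ) (∸-monoˡ-≤ 1 (⌈log₂⌉-mono-≤ r≤r′))

logMeasure-admissible : ∀ δ → Admissible δ (logMeasure δ)
logMeasure-admissible δ s r r≤ = ceilDiv-≤ (6 * 2 ^ δ) (begin
  ⌈log₂ r ⌉ ∸ 1            ≤⟨ ∸-monoˡ-≤ 1 log₂r≤ ⟩
  suc E ∸ 1                ≡⟨⟩
  6 * s * 2 ^ δ            ≡⟨ lemma s (2 ^ δ) ⟩
  s * (6 * 2 ^ δ)          ≤⟨ *-monoʳ-≤ s (n≤1+n _) ⟩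
  s * suc (6 * 2 ^ δ)      ∎)
  where
  open ≤-Reasoning
  E : ℕ
  E = 6 * s * 2 ^ δ
  lemma : ∀ s t → 6 * s * t ≡ s * (6 * t)
  lemma = solve-∀
  log₂r≤ : ⌈log₂ r ⌉ ≤ suc E
  log₂r≤ = subst (⌈log₂ r ⌉ ≤_) (⌈log₂2^n⌉≡n (suc E)) (⌈log₂⌉-mono-≤ (≤-trans r≤
    (⊔-lub (*-monoʳ-≤ 2 (m^n>0 2 E)) (m≤m+n (2 ^ E) (2 ^ E + 0)))))

logMeasure-InN : ∀ δ → InN (LNBF≥ δ) (logMeasure δ)
logMeasure-InN δ = admissible⇒InN-LNBF δ (logMeasure-mono δ) (logMeasure-admissible δ)

moreThanTwo : ℕ → ℕ
moreThanTwo (suc (suc (suc _))) = 1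
moreThanTwo _                   = 0

moreThanTwo-mono : NonDecreasing moreThanTwo
moreThanTwo-mono {suc (suc (suc _))} (s≤s (s≤s (s≤s _))) = ≤-refl
moreThanTwo-mono {zero}             _ = z≤n
moreThanTwo-mono {suc zero}         _ = z≤n
moreThanTwo-mono {suc (suc zero)}   _ = z≤n

moreThanTwo-admissible : ∀ δ → Admissible δ moreThanTwo
moreThanTwo-admissible δ zero    (suc (suc (suc _))) (s≤s (s≤s ()))
moreThanTwo-admissible δ zero    zero                _ = z≤n
moreThanTwo-admissible δ zero    (suc zero)          _ = z≤n
moreThanTwo-admissible δ zero    (suc (suc zero))    _ = z≤n
moreThanTwo-admissible δ (suc s) r                   _ = ≤-trans (moreThanTwo≤1 r) (s≤s z≤n)
  where
  moreThanTwo≤1 : ∀ r → moreThanTwo r ≤ 1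
  moreThanTwo≤1 (suc (suc (suc _))) = ≤-refl
  moreThanTwo≤1 zero                = z≤n
  moreThanTwo≤1 (suc zero)          = z≤n
  moreThanTwo≤1 (suc (suc zero))    = z≤n

moreThanTwo-InN : ∀ δ → InN (LNBF≥ δ) moreThanTwo
moreThanTwo-InN δ = admissible⇒InN-LNBF δ moreThanTwo-mono (moreThanTwo-admissible δ)

lsb : ℕ → Bool
lsb zero             = false
lsb (suc zero)       = true
lsb (suc (suc n))    = lsb n

lsb+2*⌊n/2⌋≡n : ∀ n → (if lsb n then 1 else 0) + 2 * ⌊ n /2⌋ ≡ n
lsb+2*⌊n/2⌋≡n zero          = refl
lsb+2*⌊n/2⌋≡n (suc zero)    = refl
lsb+2*⌊n/2⌋≡n (suc (suc n)) = trans (lemma (if lsb n then 1 else 0) ⌊ n /2⌋) (cong (2 +_) (lsb+2*⌊n/2⌋≡n n))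
  where
  lemma : ∀ b h → b + 2 * suc h ≡ suc (suc (b + 2 * h))
  lemma = solve-∀

⌊n/2⌋<m : ∀ {n m} → n < 2 * m → ⌊ n /2⌋ < m
⌊n/2⌋<m {n} {m} n<2m = *-cancelˡ-< 2 ⌊ n /2⌋ m (begin-strict
  2 * ⌊ n /2⌋                           ≤⟨ m≤n+m (2 * ⌊ n /2⌋) (if lsb n then 1 else 0) ⟩
  (if lsb n then 1 else 0) + 2 * ⌊ n /2⌋ ≡⟨ lsb+2*⌊n/2⌋≡n n ⟩
  n                                     <⟨ n<2m ⟩
  2 * m                                 ∎)
  where open ≤-Reasoning

-- Little-endian, as read by num.
bitOf : ℕ → ℕ → Bool
bitOf i zero    = lsb i
bitOf i (suc t) = bitOf ⌊ i /2⌋ t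

bitOf-zero : ∀ t → bitOf 0 t ≡ false
bitOf-zero zero    = refl
bitOf-zero (suc t) = bitOf-zero t

num-bitOf : ∀ len start (y : ℕ → Bool) {i} → i < 2 ^ len
  → (∀ t → t < len → y (start + t) ≡ bitOf i t) → num y start len ≡ i
num-bitOf zero      start y i<1 _ = sym (n<1⇒n≡0 i<1)
num-bitOf (suc len) start y {i} i< y≡ = begin
  (if y start then 1 else 0) + 2 * num y (suc start) len
    ≡⟨ cong₂ (λ b h → (if b then 1 else 0) + 2 * h) y-start
             (num-bitOf len (suc start) y (⌊n/2⌋<m i<) y≡′) ⟩
  (if lsb i then 1 else 0) + 2 * ⌊ i /2⌋ ≡⟨ lsb+2*⌊n/2⌋≡n i ⟩
  i ∎
  where
  open ≡-Reasoning
  y-start : y start ≡ lsb i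
  y-start = trans (cong y (sym (+-identityʳ start))) (y≡ 0 (s≤s z≤n))
  y≡′ : ∀ t → t < len → y (suc start + t) ≡ bitOf ⌊ i /2⌋ t
  y≡′ t t< = trans (cong y (sym (+-suc start t))) (y≡ (suc t) (s≤s t<))

bitOf-injective : ∀ len {c c′} → c < 2 ^ len → c′ < 2 ^ len
  → (∀ t → t < len → bitOf c t ≡ bitOf c′ t) → c ≡ c′
bitOf-injective len {c} {c′} c< c′< agree =
  trans (sym (num-bitOf len 0 (bitOf c) c< (λ _ _ → refl))) (num-bitOf len 0 (bitOf c) c′< agree)

n≤2^⌈log₂n⌉ : ∀ n → n ≤ 2 ^ ⌈log₂ n ⌉
n≤2^⌈log₂n⌉ = <-rec _ go
  where
  go : ∀ n → (∀ {m} → m < n → m ≤ 2 ^ ⌈log₂ m ⌉) → n ≤ 2 ^ ⌈log₂ n ⌉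
  go zero             _   = z≤n
  go (suc zero)       _   = s≤s z≤n
  go n@(suc (suc n′)) rec = begin
    n                              ≡⟨ sym (⌊n/2⌋+⌈n/2⌉≡n n) ⟩
    ⌊ n /2⌋ + ⌈ n /2⌉              ≤⟨ +-monoˡ-≤ ⌈ n /2⌉ (⌊n/2⌋≤⌈n/2⌉ n) ⟩
    ⌈ n /2⌉ + ⌈ n /2⌉              ≡⟨ cong (⌈ n /2⌉ +_) (sym (+-identityʳ ⌈ n /2⌉)) ⟩
    2 * ⌈ n /2⌉                    ≤⟨ *-monoʳ-≤ 2 (rec (s<s (⌊n/2⌋<n n′))) ⟩
    2 * 2 ^ ⌈log₂ ⌈ n /2⌉ ⌉        ≡⟨ cong (λ e → 2 * 2 ^ e) (⌈log₂⌈n/2⌉⌉≡⌈log₂n⌉∸1 n) ⟩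
    2 ^ suc (⌈log₂ n ⌉ ∸ 1)        ≡⟨ cong (2 ^_) (m+[n∸m]≡n (⌈log₂⌉-mono-≤ {2} {n} (s≤s (s≤s z≤n)))) ⟩
    2 ^ ⌈log₂ n ⌉                  ∎
    where open ≤-Reasoning

m+1≤2m : ∀ m → 1 ≤ m → suc m ≤ 2 * m
m+1≤2m m 1≤m = subst (suc m ≤_) (cong (m +_) (sym (+-identityʳ m))) (+-monoˡ-≤ m 1≤m)

n≤2^a⇒⌈log₂n⌉≤a : ∀ {n} a → n ≤ 2 ^ a → ⌈log₂ n ⌉ ≤ a
n≤2^a⇒⌈log₂n⌉≤a {n} a n≤2^a = subst (⌈log₂ n ⌉ ≤_) (⌈log₂2^n⌉≡n a) (⌈log₂⌉-mono-≤ n≤2^a)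

power-between : ∀ n → 1 ≤ n → ∃ λ a → n ≤ 2 ^ a × 2 ^ a < 2 * n
power-between (suc zero)    _ = 0 , s≤s z≤n , s≤s (s≤s z≤n)
power-between (suc (suc n)) _ with power-between (suc n) (s≤s z≤n)
... | a , n≤ , <2n with m≤n⇒m<n∨m≡n n≤
...   | inj₁ n< = a , n< , <-trans <2n (*-monoʳ-< 2 (n<1+n (suc n)))
...   | inj₂ n≡ = suc a , subst (suc (suc n) ≤_) (cong (2 *_) n≡) (m+1≤2m (suc n) (s≤s z≤n))
                        , subst (_< 2 * suc (suc n)) (cong (2 *_) n≡) (*-monoʳ-< 2 (n<1+n (suc n)))

2^⌈log₂n⌉≤2n : ∀ n → 1 ≤ n → 2 ^ ⌈log₂ n ⌉ ≤ 2 * n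
2^⌈log₂n⌉≤2n n 1≤n with power-between n 1≤n
... | a , n≤2^a , 2^a<2n = ≤-trans (^-monoʳ-≤ 2 (n≤2^a⇒⌈log₂n⌉≤a a n≤2^a)) (<⇒≤ 2^a<2n)

n≤2^n : ∀ n → n ≤ 2 ^ n
n≤2^n zero    = z≤n
n≤2^n (suc n) = +-mono-≤ (m^n>0 2 n) (≤-trans (n≤2^n n) (m≤m+n _ 0))

⌈log₂n⌉≤n : ∀ n → ⌈log₂ n ⌉ ≤ n
⌈log₂n⌉≤n n = n≤2^a⇒⌈log₂n⌉≤a n (n≤2^n n)

2^k≤n⇒k≤⌈log₂n⌉ : ∀ {k n} → 2 ^ k ≤ n → k ≤ ⌈log₂ n ⌉
2^k≤n⇒k≤⌈log₂n⌉ {k} 2^k≤n = subst (_≤ _) (⌈log₂2^n⌉≡n k) (⌈log₂⌉-mono-≤ 2^k≤n)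

isaLen-suc≤ : ∀ k → 1 ≤ k → isaLen (suc k) ≤ 18 * (k * 2 ^ k)
isaLen-suc≤ k 1≤k = begin
  suc k + 2 ^ suc k * (suc k + g) + 2 ^ (suc k + g)
     ≡⟨ cong (suc k + 2 ^ suc k * (suc k + g) +_) (^-distribˡ-+-* 2 (suc k) g) ⟩
  suc k + 2 * t * (suc k + g) + 2 * t * 2 ^ g
     ≤⟨ +-mono-≤ (+-mono-≤ 1+k≤2kt (*-monoʳ-≤ (2 * t) 1+k+g≤4k)) (*-monoʳ-≤ (2 * t) 2^g≤4k) ⟩
  2 * k * t + 2 * t * (4 * k) + 2 * t * (4 * k)
     ≡⟨ lemma k t ⟩
  18 * (k * t) ∎
  where
  open ≤-Reasoning
  t g : ℕ
  t = 2 ^ k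
  g = ⌈log₂ suc k ⌉
  1+k≤2k : suc k ≤ 2 * k
  1+k≤2k = m+1≤2m k 1≤k
  2+2k≤4k : 2 * suc k ≤ 4 * k
  2+2k≤4k = subst (2 * suc k ≤_) (sym (*-assoc 2 2 k)) (*-monoʳ-≤ 2 1+k≤2k)
  1+k≤2kt : suc k ≤ 2 * k * t
  1+k≤2kt = ≤-trans 1+k≤2k (m≤m*n (2 * k) t {{>-nonZero (m^n>0 2 k)}})
  1+k+g≤4k : suc k + g ≤ 4 * k
  1+k+g≤4k = ≤-trans (+-monoʳ-≤ (suc k) (⌈log₂n⌉≤n (suc k)))
               (subst (_≤ 4 * k) (cong (suc k +_) (+-identityʳ (suc k))) 2+2k≤4k)
  2^g≤4k : 2 ^ g ≤ 4 * k
  2^g≤4k = ≤-trans (2^⌈log₂n⌉≤2n (suc k) (s≤s z≤n)) 2+2k≤4k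
  lemma : ∀ k t → 2 * k * t + 2 * t * (4 * k) + 2 * t * (4 * k) ≡ 18 * (k * t)
  lemma = solve-∀

k*2^k≤2^ell : ∀ k → k * 2 ^ k ≤ 2 ^ ell k
k*2^k≤2^ell k = begin
  k * 2 ^ k             ≡⟨ *-comm k (2 ^ k) ⟩
  2 ^ k * k             ≤⟨ *-monoʳ-≤ (2 ^ k) (n≤2^⌈log₂n⌉ k) ⟩
  2 ^ k * 2 ^ ⌈log₂ k ⌉ ≡⟨ sym (^-distribˡ-+-* 2 k ⌈log₂ k ⌉) ⟩
  2 ^ ell k             ∎
  where open ≤-Reasoning

-- The layout of ISA

bestK-fits : ∀ n j → 1 ≤ j → isaLen 1 ≤ n → 1 ≤ bestK n j × isaLen (bestK n j) ≤ n
bestK-fits n (suc j) _ fits₁ with isaLen (suc j) ≤ᵇ n in fits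
... | true = s≤s z≤n , ≤ᵇ⇒≤ _ _ (subst T (sym fits) _)
bestK-fits n (suc zero)    _ fits₁ | false = ⊥-elim (subst T fits (≤⇒≤ᵇ fits₁))
bestK-fits n (suc (suc j)) _ fits₁ | false = bestK-fits n (suc j) (s≤s z≤n) fits₁

bestK-maximal : ∀ n j {j′} → bestK n j < j′ → j′ ≤ j → n < isaLen j′
bestK-maximal n zero    best< j′≤0 = ⊥-elim (<⇒≱ best< (≤-trans j′≤0 z≤n))
bestK-maximal n (suc j) {j′} best< j′≤ with isaLen (suc j) ≤ᵇ n in fits
... | true  = ⊥-elim (<⇒≱ best< j′≤)
... | false with m≤n⇒m<n∨m≡n j′≤
...   | inj₁ j′<  = bestK-maximal n j best< (≤-pred j′<)
...   | inj₂ refl = ≰⇒> (λ fits′ → subst T fits (≤⇒≤ᵇ fits′))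

bitAt-≗ : ∀ {n} {x y : Assignment n} → x ≗ y → ∀ p → bitAt x p ≡ bitAt y p
bitAt-≗ {n} x≗y p with p <? n
... | yes _ = x≗y _
... | no  _ = refl

bitAt-agrees : ∀ {n} (x : Assignment n) (X : ℕ → Bool) → (∀ q → x q ≡ X (toℕ q)) → ∀ {p} → p < n → bitAt x p ≡ X p
bitAt-agrees {n} x X x≡X {p} p<n with p <? n
... | yes p<n′ = trans (x≡X _) (cong X (FP.toℕ-fromℕ< p<n′))
... | no  p≮n  = ⊥-elim (p≮n p<n)

num-cong : ∀ {y y′ : ℕ → Bool} → y ≗ y′ → ∀ start len → num y start len ≡ num y′ start len
num-cong y≗ start zero      = refl
num-cong y≗ start (suc len) = cong₂ (λ b h → (if b then 1 else 0) + 2 * h) (y≗ start) (num-cong y≗ (suc start) len)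

isaKL-cong : ∀ k ℓ {y y′ : ℕ → Bool} → y ≗ y′ → isaKL k ℓ y ≡ isaKL k ℓ y′
isaKL-cong k ℓ {y} {y′} y≗ = trans (y≗ _) (cong (λ v → y′ (k + 2 ^ k * ℓ + v))
  (trans (cong (λ w → num y (k + w * ℓ) ℓ) (num-cong y≗ 0 k)) (num-cong y≗ _ ℓ)))

ISA-ext : ∀ n → Extensional (ISA n)
ISA-ext n x≗y = cong (if n ≤ᵇ 4 then false else_) (isaKL-cong (bestK n n) (ell (bestK n n)) (bitAt-≗ x≗y))

singletons : ∀ n → Partition n n
singletons n = record { colour = id ; surj = λ i → i , refl }

does-≟-toℕ : ∀ {n} (i j : Fin n) → does (i F.≟ j) ≡ does (toℕ i ℕ.≟ toℕ j)
does-≟-toℕ i j with i F.≟ j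
... | yes i≡j = sym (dec-true (toℕ i ℕ.≟ toℕ j) (cong toℕ i≡j))
... | no  i≢j = sym (dec-false (toℕ i ℕ.≟ toℕ j) (i≢j ∘ FP.toℕ-injective))

other : ℕ → ℕ
other zero    = 1
other (suc _) = 0

other-≢ : ∀ u → other u ≢ u
other-≢ zero    ()
other-≢ (suc _) ()

other<2 : ∀ u → other u < 2
other<2 zero    = s≤s (s≤s z≤n)
other<2 (suc _) = s≤s z≤n

n≤ᵇ4≡false : ∀ {n} → 5 ≤ n → (n ≤ᵇ 4) ≡ false
n≤ᵇ4≡false (s≤s (s≤s (s≤s (s≤s (s≤s _))))) = refl

module ISALayout (n : ℕ) (5≤n : 5 ≤ n) where

  k ℓ dataStart : ℕ
  k = bestK n n
  ℓ = ell k
  dataStart = k + 2 ^ k * ℓ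

  1≤k : 1 ≤ k
  1≤k = proj₁ (bestK-fits n n (≤-trans (s≤s z≤n) 5≤n) 5≤n)

  fits : dataStart + 2 ^ ℓ ≤ n
  fits = proj₂ (bestK-fits n n (≤-trans (s≤s z≤n) 5≤n) 5≤n)

  n<isaLen[1+k] : n < isaLen (suc k)
  n<isaLen[1+k] with suc k ≤? n
  ... | yes 1+k≤n = bestK-maximal n n ≤-refl 1+k≤n
  ... | no  1+k≰n = <-≤-trans (≰⇒> 1+k≰n) (≤-trans (m≤m+n (suc k) _) (m≤m+n _ _))

  1≤ℓ : 1 ≤ ℓ
  1≤ℓ = ≤-trans 1≤k (m≤m+n k _)

  dataStart≤n : dataStart ≤ n
  dataStart≤n = ≤-trans (m≤m+n dataStart _) fits

  k≤dataStart : k ≤ dataStart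
  k≤dataStart = m≤m+n k _

  k+ℓ≤dataStart : k + ℓ ≤ dataStart
  k+ℓ≤dataStart = +-monoʳ-≤ k (m≤n*m ℓ (2 ^ k) {{>-nonZero (m^n>0 2 k)}})

  pointer<dataStart : ∀ {j t} → j < 2 ^ k → t < ℓ → k + j * ℓ + t < dataStart
  pointer<dataStart {j} {t} j< t< = subst (_< dataStart) (sym (+-assoc k (j * ℓ) t)) (+-monoʳ-< k (begin-strict
    j * ℓ + t  <⟨ +-monoʳ-< (j * ℓ) t< ⟩
    j * ℓ + ℓ  ≡⟨ +-comm (j * ℓ) ℓ ⟩
    suc j * ℓ  ≤⟨ *-monoˡ-≤ ℓ j< ⟩
    2 ^ k * ℓ  ∎))
    where open ≤-Reasoning

  ISA-read : ∀ (X : ℕ → Bool) (x : Assignment n) → (∀ q → x q ≡ X (toℕ q))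
    → ∀ {j u} → j < 2 ^ k → u < 2 ^ ℓ
    → (∀ t → t < k → X t ≡ bitOf j t) → (∀ t → t < ℓ → X (k + j * ℓ + t) ≡ bitOf u t)
    → ISA n x ≡ X (dataStart + u)
  ISA-read X x x≡X {j} {u} j< u< primary secondary = begin
    ISA n x                                                      ≡⟨ cong (if_then false else isaKL k ℓ (bitAt x)) (n≤ᵇ4≡false 5≤n) ⟩
    bitAt x (dataStart + num (bitAt x) (k + num (bitAt x) 0 k * ℓ) ℓ) ≡⟨ cong (λ i → bitAt x (dataStart + num (bitAt x) (k + i * ℓ) ℓ)) primary≡ ⟩
    bitAt x (dataStart + num (bitAt x) (k + j * ℓ) ℓ)            ≡⟨ cong (λ i → bitAt x (dataStart + i)) secondary≡ ⟩
    bitAt x (dataStart + u)                                      ≡⟨ read (<-≤-trans (+-monoʳ-< dataStart u<) fits) ⟩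
    X (dataStart + u)                                            ∎
    where
    open ≡-Reasoning
    read : ∀ {p} → p < n → bitAt x p ≡ X p
    read = bitAt-agrees x X x≡X
    primary≡ : num (bitAt x) 0 k ≡ j
    primary≡ = num-bitOf k 0 (bitAt x) j< λ t t< →
      trans (read (<-≤-trans t< (≤-trans k≤dataStart dataStart≤n))) (primary t t<)
    secondary≡ : num (bitAt x) (k + j * ℓ) ℓ ≡ u
    secondary≡ = num-bitOf ℓ (k + j * ℓ) (bitAt x) u< λ t t< →
      trans (read (<-≤-trans (pointer<dataStart j< t<) dataStart≤n)) (secondary t t<)

  instance
    ℓ-nonZero : NonZero ℓ
    ℓ-nonZero = >-nonZero 1≤ℓ

  -- Colour 1 + j for the j-th secondary pointer, 0 for every other position.
  pointerBlock : ℕ → Fin (suc (2 ^ k))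
  pointerBlock p with k ≤? p | p <? dataStart
  ... | yes k≤p | yes p<D = F.suc (fromℕ< (m<n*o⇒m/o<n (offset< k≤p p<D)))
    where
    offset< : k ≤ p → p < dataStart → p ∸ k < 2 ^ k * ℓ
    offset< k≤p p<D = +-cancelˡ-< k (p ∸ k) _ (subst (_< dataStart) (sym (m+[n∸m]≡n k≤p)) p<D)
  ... | _ | _ = F.zero

  pointerBlock-primary : ∀ {p} → p < k → pointerBlock p ≡ F.zero
  pointerBlock-primary {p} p<k with k ≤? p | p <? dataStart
  ... | yes k≤p | _ = ⊥-elim (<⇒≱ p<k k≤p)
  ... | no  _   | _ = refl

  pointerBlock-data : ∀ {p} → dataStart ≤ p → pointerBlock p ≡ F.zero
  pointerBlock-data {p} D≤p with k ≤? p | p <? dataStart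
  ... | _     | yes p<D = ⊥-elim (<⇒≱ p<D D≤p)
  ... | yes _ | no  _   = refl
  ... | no  _ | no  _   = refl

  pointerBlock-pointer : ∀ (j : Fin (2 ^ k)) {t} → t < ℓ → pointerBlock (k + toℕ j * ℓ + t) ≡ F.suc j
  pointerBlock-pointer j {t} t< with k ≤? k + toℕ j * ℓ + t | k + toℕ j * ℓ + t <? dataStart
  ... | yes _   | yes _ = cong F.suc (trans (FP.fromℕ<-cong _ _ offset/ℓ≡j _ (FP.toℕ<n j)) (FP.fromℕ<-toℕ j (FP.toℕ<n j)))
    where
    open ≡-Reasoning
    offset/ℓ≡j : (k + toℕ j * ℓ + t ∸ k) / ℓ ≡ toℕ j
    offset/ℓ≡j = begin
      (k + toℕ j * ℓ + t ∸ k) / ℓ    ≡⟨ cong (_/ ℓ) (trans (cong (_∸ k) (+-assoc k _ t)) (m+n∸m≡n k _)) ⟩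
      (toℕ j * ℓ + t) / ℓ            ≡⟨ +-distrib-/ (toℕ j * ℓ) t (subst₂ (λ a b → a + b < ℓ) (sym (m*n%n≡0 (toℕ j) ℓ)) (sym (m<n⇒m%n≡m t<)) t<) ⟩
      toℕ j * ℓ / ℓ + t / ℓ          ≡⟨ cong₂ _+_ (m*n/n≡m (toℕ j) ℓ) (m<n⇒m/n≡0 t<) ⟩
      toℕ j + 0                      ≡⟨ +-identityʳ (toℕ j) ⟩
      toℕ j                          ∎
  ... | no  k≰ | _     = ⊥-elim (k≰ (≤-trans (m≤m+n k _) (m≤m+n _ t)))
  ... | yes _  | no p≮ = ⊥-elim (p≮ (pointer<dataStart (FP.toℕ<n j) t<))

  pointerPartition : Partition n (suc (2 ^ k))
  pointerPartition = record { colour = pointerBlock ∘ toℕ ; surj = surj }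
    where
    surj : ∀ i → ∃ λ q → pointerBlock (toℕ q) ≡ i
    surj F.zero    = fromℕ< 0<n , trans (cong pointerBlock (FP.toℕ-fromℕ< 0<n)) (pointerBlock-primary 1≤k)
      where
      0<n : 0 < n
      0<n = <-≤-trans 1≤k (≤-trans k≤dataStart dataStart≤n)
    surj (F.suc j) = fromℕ< p<n , trans (cong pointerBlock (FP.toℕ-fromℕ< p<n)) (pointerBlock-pointer j 1≤ℓ)
      where
      p<n : k + toℕ j * ℓ + 0 < n
      p<n = <-≤-trans (pointer<dataStart (FP.toℕ<n j) 1≤ℓ) dataStart≤n

  -- Fixing the primary pointer to j and the data bits to the binary digits of c
  -- makes the j-th secondary pointer block compute bit u of c from its content u.
  module PointerBlock (j : Fin (2 ^ k)) where

    V : VarSet n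
    V = block pointerPartition (F.suc j)

    fixOutside : ℕ → ℕ → Bool
    fixOutside c p = if does (p <? k) then bitOf (toℕ j) p else bitOf c (p ∸ dataStart)

    setPointer : ℕ → ℕ → Bool
    setPointer u p = bitOf u (p ∸ (k + toℕ j * ℓ))

    inBlock : ℕ → Bool
    inBlock p = does (pointerBlock p F.≟ F.suc j)

    reads-data : ∀ c {u} → u < 2 ^ ℓ → ISA n (merge V (setPointer u ∘ toℕ) (fixOutside c ∘ toℕ)) ≡ bitOf c u
    reads-data c {u} u< = trans (ISA-read X _ (λ _ → refl) (FP.toℕ<n j) u< primary secondary) data≡
      where
      X : ℕ → Bool
      X p = if inBlock p then setPointer u p else fixOutside c p
      primary : ∀ t → t < k → X t ≡ bitOf (toℕ j) t
      primary t t< rewrite pointerBlock-primary t< | dec-true (t <? k) t< = refl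
      secondary : ∀ t → t < ℓ → X (k + toℕ j * ℓ + t) ≡ bitOf u t
      secondary t t< rewrite pointerBlock-pointer j t< | dec-true (F.suc j F.≟ F.suc j) refl =
        cong (bitOf u) (m+n∸m≡n (k + toℕ j * ℓ) t)
      data≡ : X (dataStart + u) ≡ bitOf c u
      data≡ rewrite pointerBlock-data (m≤m+n dataStart u)
                  | dec-false (dataStart + u <? k) (λ p< → <⇒≱ p< (≤-trans k≤dataStart (m≤m+n dataStart u))) =
        cong (bitOf c) (m+n∸m≡n dataStart u)

    r-pointerBlock : 2 ^ 2 ^ ℓ ≤ r V (ISA n)
    r-pointerBlock = distinctSubfns⇒≤r (ISA-ext n) V (λ c → fixOutside (toℕ c) ∘ toℕ) λ {c} {c′} agree →
      FP.toℕ-injective (bitOf-injective (2 ^ ℓ) (FP.toℕ<n c) (FP.toℕ<n c′) λ u u< →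
        trans (sym (reads-data (toℕ c) u<)) (trans (agree _) (reads-data (toℕ c′) u<)))

  -- The data bit q is read as is when the secondary pointer addresses it, and is
  -- ignored (the output is the constant c) otherwise.
  module DataBit (q : Fin n) (D≤q : dataStart ≤ toℕ q) (q< : toℕ q < dataStart + 2 ^ ℓ) where

    V : VarSet n
    V = block (singletons n) q

    fixOutside : ℕ → Bool → ℕ → Bool
    fixOutside w c p = if does (p <? k) then false else if does (p <? k + ℓ) then bitOf w (p ∸ k) else c

    reads-data : ∀ s w c → w < 2 ^ ℓ
      → ISA n (merge V (λ _ → s) (fixOutside w c ∘ toℕ)) ≡ (if does (dataStart + w ℕ.≟ toℕ q) then s else c)
    reads-data s w c w< = trans (ISA-read X _ x≡X {0} (m^n>0 2 k) w< primary secondary) data≡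
      where
      X : ℕ → Bool
      X p = if does (p ℕ.≟ toℕ q) then s else fixOutside w c p
      x≡X : ∀ q′ → merge V (λ _ → s) (fixOutside w c ∘ toℕ) q′ ≡ X (toℕ q′)
      x≡X q′ = cong (if_then s else fixOutside w c (toℕ q′)) (does-≟-toℕ q′ q)
      before-data : ∀ {p} → p < dataStart → does (p ℕ.≟ toℕ q) ≡ false
      before-data p< = dec-false (_ ℕ.≟ _) λ p≡q → <⇒≱ p< (subst (dataStart ≤_) (sym p≡q) D≤q)
      primary : ∀ t → t < k → X t ≡ bitOf 0 t
      primary t t< rewrite before-data (<-≤-trans t< k≤dataStart) | dec-true (t <? k) t< = sym (bitOf-zero t)
      secondary : ∀ t → t < ℓ → X (k + 0 * ℓ + t) ≡ bitOf w t
      secondary t t< rewrite +-identityʳ k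
                           | before-data (<-≤-trans (+-monoʳ-< k t<) k+ℓ≤dataStart)
                           | dec-false (k + t <? k) (λ k+t< → <⇒≱ k+t< (m≤m+n k t))
                           | dec-true (k + t <? k + ℓ) (+-monoʳ-< k t<) = cong (bitOf w) (m+n∸m≡n k t)
      data≡ : X (dataStart + w) ≡ (if does (dataStart + w ℕ.≟ toℕ q) then s else c)
      data≡ with does (dataStart + w ℕ.≟ toℕ q)
      ... | true  = refl
      ... | false rewrite dec-false (dataStart + w <? k) (λ p< → <⇒≱ p< (≤-trans k≤dataStart (m≤m+n dataStart w)))
                        | dec-false (dataStart + w <? k + ℓ) (λ p< → <⇒≱ p< (≤-trans k+ℓ≤dataStart (m≤m+n dataStart w))) = refl

    u₀ w₁ : ℕ
    u₀ = toℕ q ∸ dataStart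
    w₁ = other u₀

    D+u₀≡q : dataStart + u₀ ≡ toℕ q
    D+u₀≡q = m+[n∸m]≡n D≤q

    u₀<2^ℓ : u₀ < 2 ^ ℓ
    u₀<2^ℓ = +-cancelˡ-< dataStart u₀ _ (subst (_< dataStart + 2 ^ ℓ) (sym D+u₀≡q) q<)

    D+w₁≢q : dataStart + w₁ ≢ toℕ q
    D+w₁≢q D+w₁≡q = other-≢ u₀ (+-cancelˡ-≡ dataStart w₁ u₀ (trans D+w₁≡q (sym D+u₀≡q)))

    w₁<2^ℓ : w₁ < 2 ^ ℓ
    w₁<2^ℓ = <-≤-trans (other<2 u₀) (^-monoʳ-≤ 2 1≤ℓ)

    restriction : Fin 3 → Assignment n
    restriction F.zero                 = fixOutside u₀ false ∘ toℕ
    restriction (F.suc F.zero)         = fixOutside w₁ true ∘ toℕ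
    restriction (F.suc (F.suc F.zero)) = fixOutside w₁ false ∘ toℕ

    subfn : Fin 3 → Bool → Bool
    subfn F.zero            s = s
    subfn (F.suc F.zero)    _ = true
    subfn (F.suc (F.suc _)) _ = false

    reads-subfn : ∀ c s → ISA n (merge V (λ _ → s) (restriction c)) ≡ subfn c s
    reads-subfn F.zero s rewrite reads-data s u₀ false u₀<2^ℓ | dec-true (dataStart + u₀ ℕ.≟ toℕ q) D+u₀≡q = refl
    reads-subfn (F.suc F.zero) s rewrite reads-data s w₁ true w₁<2^ℓ | dec-false (dataStart + w₁ ℕ.≟ toℕ q) D+w₁≢q = refl
    reads-subfn (F.suc (F.suc F.zero)) s rewrite reads-data s w₁ false w₁<2^ℓ | dec-false (dataStart + w₁ ℕ.≟ toℕ q) D+w₁≢q = refl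

    subfn-injective : ∀ {c c′} → (∀ s → subfn c s ≡ subfn c′ s) → c ≡ c′
    subfn-injective {c} {c′} agree = begin
      c                                       ≡⟨ sym (decode-subfn c) ⟩
      decode (subfn c true) (subfn c false)   ≡⟨ cong₂ decode (agree true) (agree false) ⟩
      decode (subfn c′ true) (subfn c′ false) ≡⟨ decode-subfn c′ ⟩
      c′                                      ∎
      where
      open ≡-Reasoning
      decode : Bool → Bool → Fin 3
      decode true  false = F.zero
      decode true  true  = F.suc F.zero
      decode false _     = F.suc (F.suc F.zero)
      decode-subfn : ∀ c → decode (subfn c true) (subfn c false) ≡ c
      decode-subfn F.zero                 = refl
      decode-subfn (F.suc F.zero)         = refl
      decode-subfn (F.suc (F.suc F.zero)) = refl

    r-dataBit : 3 ≤ r V (ISA n)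
    r-dataBit = distinctSubfns⇒≤r (ISA-ext n) V restriction λ {c} {c′} agree →
      subfn-injective λ s → trans (sym (reads-subfn c s)) (trans (agree _) (reads-subfn c′ s))

-- Lower bounds for ISA

sumFin-≥ : ∀ p (g : Fin p → ℕ) {β} → (∀ i → β ≤ g i) → p * β ≤ sumFin p g
sumFin-≥ zero    g β≤ = z≤n
sumFin-≥ (suc p) g β≤ = +-mono-≤ (β≤ F.zero) (sumFin-≥ p (g ∘ F.suc) (β≤ ∘ F.suc))

sumFin-≥-range : ∀ n (g : Fin n → ℕ) start len → start + len ≤ n
  → (∀ q → start ≤ toℕ q → toℕ q < start + len → 1 ≤ g q) → len ≤ sumFin n g
sumFin-≥-range zero    g start len fits g≥ = ≤-trans (m≤n+m len start) fits
sumFin-≥-range (suc n) g zero zero _ _ = z≤n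
sumFin-≥-range (suc n) g zero (suc len) fits g≥ = +-mono-≤ (g≥ F.zero z≤n (s≤s z≤n))
  (sumFin-≥-range n (g ∘ F.suc) 0 len (≤-pred fits) (λ q _ q< → g≥ (F.suc q) z≤n (s≤s q<)))
sumFin-≥-range (suc n) g (suc start) len fits g≥ = ≤-trans
  (sumFin-≥-range n (g ∘ F.suc) start len (≤-pred fits) (λ q s≤ q< → g≥ (F.suc q) (s≤s s≤) (s≤s q<)))
  (m≤n+m _ (g F.zero))

P≤2[P∸1] : ∀ P → 2 ≤ P → P ≤ 2 * (P ∸ 1)
P≤2[P∸1] (suc (suc P)) _ = m+1≤2m (suc P) (s≤s z≤n)
P≤2[P∸1] (suc zero) (s≤s ())

quadratic-arith : ∀ {n k t β d L S} → 1 ≤ d → n ≤ 18 * (k * t) → k * t ≤ 2 * (β * suc (6 * d))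
  → k ≤ L → t * β ≤ S → n * n ≤ 4536 * d * L * S
quadratic-arith {n} {k} {t} {β} {d} {L} {S} 1≤d n≤ kt≤ k≤L tβ≤S = begin
  n * n                                   ≤⟨ *-mono-≤ n≤ n≤ ⟩
  18 * (k * t) * (18 * (k * t))           ≤⟨ *-monoʳ-≤ (18 * (k * t)) (*-monoʳ-≤ 18 (≤-trans kt≤ (*-monoʳ-≤ 2 (*-monoʳ-≤ β 1+6d≤7d)))) ⟩
  18 * (k * t) * (18 * (2 * (β * (7 * d)))) ≡⟨ lemma k t β d ⟩
  4536 * d * k * (t * β)                  ≤⟨ *-mono-≤ (*-monoʳ-≤ (4536 * d) k≤L) tβ≤S ⟩
  4536 * d * L * S                        ∎
  where
  open ≤-Reasoning
  1+6d≤7d : suc (6 * d) ≤ 7 * d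
  1+6d≤7d = +-monoˡ-≤ (6 * d) 1≤d
  lemma : ∀ k t β d → 18 * (k * t) * (18 * (2 * (β * (7 * d)))) ≡ 4536 * d * k * (t * β)
  lemma = solve-∀

module ISABounds (n : ℕ) (5≤n : 5 ≤ n) where
  open ISALayout n 5≤n

  n≤18k2^k : n ≤ 18 * (k * 2 ^ k)
  n≤18k2^k = ≤-trans (<⇒≤ n<isaLen[1+k]) (isaLen-suc≤ k 1≤k)

  k≤⌈log₂n⌉ : k ≤ ⌈log₂ n ⌉
  k≤⌈log₂n⌉ = 2^k≤n⇒k≤⌈log₂n⌉ (≤-trans (m≤m*n (2 ^ k) ℓ) (≤-trans (m≤n+m _ k) dataStart≤n))

  ISA-quadratic : ∀ δ → n * n ≤ 4536 * 2 ^ δ * ⌈log₂ n ⌉ * nsum (logMeasure δ) pointerPartition (ISA n)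
  ISA-quadratic δ = quadratic-arith (m^n>0 2 δ) n≤18k2^k k2^k≤ k≤⌈log₂n⌉ 2^kβ≤
    where
    β : ℕ
    β = logMeasure δ (2 ^ 2 ^ ℓ)
    k2^k≤ : k * 2 ^ k ≤ 2 * (β * suc (6 * 2 ^ δ))
    k2^k≤ = begin
      k * 2 ^ k                         ≤⟨ k*2^k≤2^ell k ⟩
      2 ^ ℓ                             ≤⟨ P≤2[P∸1] (2 ^ ℓ) (^-monoʳ-≤ 2 1≤ℓ) ⟩
      2 * (2 ^ ℓ ∸ 1)                   ≡⟨ cong (λ e → 2 * (e ∸ 1)) (sym (⌈log₂2^n⌉≡n (2 ^ ℓ))) ⟩
      2 * (⌈log₂ 2 ^ 2 ^ ℓ ⌉ ∸ 1)       ≤⟨ *-monoʳ-≤ 2 (≤ceilDiv* (6 * 2 ^ δ) (⌈log₂ 2 ^ 2 ^ ℓ ⌉ ∸ 1)) ⟩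
      2 * (β * suc (6 * 2 ^ δ))         ∎
      where open ≤-Reasoning
    2^kβ≤ : 2 ^ k * β ≤ nsum (logMeasure δ) pointerPartition (ISA n)
    2^kβ≤ = ≤-trans (sumFin-≥ (2 ^ k) _ (λ j → logMeasure-mono δ (PointerBlock.r-pointerBlock j))) (m≤n+m _ _)

  ISA-linear : n ≤ 18 * nsum moreThanTwo (singletons n) (ISA n)
  ISA-linear = ≤-trans n≤18k2^k (*-monoʳ-≤ 18 (≤-trans (k*2^k≤2^ell k)
    (sumFin-≥-range n _ dataStart (2 ^ ℓ) fits λ q D≤q q< → moreThanTwo-mono (DataBit.r-dataBit q D≤q q<))))

  LNBF-quadratic : ∀ δ → LSat (LNBF≥ δ) ISA n (λ S → n * n ≤ 4536 * 2 ^ δ * ⌈log₂ n ⌉ * S)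
  LNBF-quadratic δ = logMeasure δ , logMeasure-InN δ , _ , pointerPartition , ISA-quadratic δ

  LNBF-linear : ∀ δ → LSat (LNBF≥ δ) ISA n (λ S → n ≤ 4536 * S)
  LNBF-linear δ = moreThanTwo , moreThanTwo-InN δ , _ , singletons n ,
    ≤-trans ISA-linear (*-monoˡ-≤ (nsum moreThanTwo (singletons n) (ISA n)) (m≤m+n 18 4518))

  BF-quadratic : LSat BF≥ ISA n (λ S → n * n ≤ 4536 * ⌈log₂ n ⌉ * S)
  BF-quadratic = logMeasure 0 , InN-LNBF₀⇒InN-BF (logMeasure-InN 0) , _ , pointerPartition , ISA-quadratic 0

proposition8p2 : ((Δ : ℕ → ℕ) → Σ ℕ λ C → Σ ℕ λ N → (n : ℕ) → N ≤ n
                   → LSat (LNBF≥ (Δ n)) ISA n (λ S → n * n ≤ C * 2 ^ Δ n * ⌈log₂ n ⌉ * S)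
                     × LSat (LNBF≥ (Δ n)) ISA n (λ S → n ≤ C * S))
                 × (Σ ℕ λ C → Σ ℕ λ N → (n : ℕ) → N ≤ n
                   → LSat BF≥ ISA n (λ S → n * n ≤ C * ⌈log₂ n ⌉ * S))
proposition8p2 =
  (λ Δ → 4536 , 5 , λ n 5≤n → ISABounds.LNBF-quadratic n 5≤n (Δ n) , ISABounds.LNBF-linear n 5≤n (Δ n)) ,
  (4536 , 5 , ISABounds.BF-quadratic)
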